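{- Let $(e_k)_{k\ge0}$ be a $q$-Catalan basis associated to the Catalan power series $P$, with predual basis $(\tilde e_i)$ and dual coefficients $(T_i)_{i\in\mathbb N^2}$. Let $A$ and $M$ be the operators $Af(z)=P(z,1)f(qz)$, $Mf(z)=zf(z)$, and let $T=\sum_{i=(i_1,i_2)\in\mathbb N^2}T_iM^{i_1}A^{i_2}$. Then (i) $Te_k=q^ke_k$ for every nonnegative integer $k$; (ii) $Tf(z)=\sum_{i=(i_1,i_2)\in\mathbb N^2}T_i\tilde e_i(z,1)f(q^{i_2}z)$ for every power series $f$.
   Context: $q$ is a fixed parameter; all series are formal. A Catalan power series is a power series $P(z,t)$ with $P(z,t)=t-z\tilde P(z,t)t^2$ for some power series $\tilde P$. A family of power series $(e_k)_{k\ge0}$ is a $q$-Catalan basis associated to $P$ if $e_k(qz)/e_k(z)=P(z,q^k)/P(z,1)$ for all $k\ge0$. The predual basis of $P$ is $\tilde e_i(z,t)=z^{i_1}\prod_{0\le j<i_2}P(q^jz,t)$ for $i=(i_1,i_2)\in\mathbb N^2$ (empty product $=1$), a basis of power series in $(z,t)$; the dual coefficients $(T_i)$ are the unique numbers with $\sum_iT_i\tilde e_i(z,t)=t$. -}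

module Defs where

open import Level using (Level)
open import Data.Nat using (ℕ; zero; suc; _∸_; _≤_)
open import Data.Product using (Σ; _×_)
open import Data.Sum using (_⊎_)
open import Algebra.Bundles using (CommutativeRing)

module Series {c ℓ : Level} (R : CommutativeRing c ℓ) where
  open CommutativeRing R renaming (Carrier to K)

  sumTo : ℕ → (ℕ → K) → K
  sumTo zero    f = 0#
  sumTo (suc n) f = sumTo n f + f n

  pow : K → ℕ → K
  pow x zero    = 1#
  pow x (suc n) = pow x n * x

  PS : Set c
  PS = ℕ → K

  _≋_ : PS → PS → Set ℓ
  f ≋ g = ∀ n → f n ≈ g n

  oneS : PS
  oneS zero    = 1#
  oneS (suc n) = 0#

  _⊛_ : PS → PS → PS
  (f ⊛ g) n = sumTo (suc n) (λ a → f a * g (n ∸ a))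

  scale : K → PS → PS
  scale x f n = x * f n

  dil : K → PS → PS
  dil x f n = pow x n * f n

  shiftZ : ℕ → PS → PS
  shiftZ zero    f n       = f n
  shiftZ (suc i) f zero    = 0#
  shiftZ (suc i) f (suc n) = shiftZ i f n

  iter : (PS → PS) → ℕ → PS → PS
  iter F zero    f = f
  iter F (suc n) f = F (iter F n f)

  -- bivariate power series in (z,t) :  F n m = coefficient of z^n t^m
  PS2 : Set c
  PS2 = ℕ → ℕ → K

  oneS2 : PS2
  oneS2 zero    zero    = 1#
  oneS2 zero    (suc m) = 0#
  oneS2 (suc n) m       = 0#

  tSer2 : PS2
  tSer2 zero    zero          = 0#
  tSer2 zero    (suc zero)    = 1#
  tSer2 zero    (suc (suc m)) = 0#
  tSer2 (suc n) m             = 0#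

  _⊛₂_ : PS2 → PS2 → PS2
  (F ⊛₂ G) n m = sumTo (suc n) (λ a → sumTo (suc m) (λ b →
                   F a b * G (n ∸ a) (m ∸ b)))

  scale2 : K → PS2 → PS2
  scale2 x F n m = x * F n m

  dil2 : K → PS2 → PS2
  dil2 x F n m = pow x n * F n m

  shiftZ2 : ℕ → PS2 → PS2
  shiftZ2 zero    F n       m = F n m
  shiftZ2 (suc i) F zero    m = 0#
  shiftZ2 (suc i) F (suc n) m = shiftZ2 i F n m

  shiftT2 : ℕ → PS2 → PS2
  shiftT2 zero    F n m       = F n m
  shiftT2 (suc j) F n zero    = 0#
  shiftT2 (suc j) F n (suc m) = shiftT2 j F n m

  IsCatalan : PS2 → Set (c Level.⊔ ℓ)
  IsCatalan P = Σ PS2 λ P~ → ∀ n m →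
    P n m ≈ tSer2 n m - shiftZ2 1 (shiftT2 2 P~) n m

  -- evaluation t := x of a bivariate series P which, for every n, has
  -- coefficients P n m = 0 for m ≥ B n  (B is a bound witnessing that
  -- P(z,x) is a well-defined power series in z)
  evalT : (B : ℕ → ℕ) → PS2 → K → PS
  evalT B P x n = sumTo (B n) (λ m → P n m * pow x m)

  prodP2 : K → PS2 → ℕ → PS2
  prodP2 q P zero    = oneS2
  prodP2 q P (suc j) = prodP2 q P j ⊛₂ dil2 (pow q j) P

  predual : K → PS2 → ℕ → ℕ → PS2
  predual q P i₁ i₂ = shiftZ2 i₁ (prodP2 q P i₂)

  prodP1 : K → PS → ℕ → PS
  prodP1 q P1 zero    = oneS
  prodP1 q P1 (suc j) = prodP1 q P1 j ⊛ dil (pow q j) P1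

  predualAt1 : K → PS → ℕ → ℕ → PS
  predualAt1 q P1 i₁ i₂ = shiftZ i₁ (prodP1 q P1 i₂)

  -- formal summation of a family indexed by ℕ² :  for every coefficient,
  -- only finitely many members of the family contribute (all vanish outside
  -- a box [0,N)²), and the (finite) sum of contributions is the coefficient
  -- of s.
  HasSum : (ℕ → ℕ → PS) → PS → Set ℓ
  HasSum F s = ∀ n → Σ ℕ λ N →
    (∀ a b → (N ≤ a ⊎ N ≤ b) → F a b n ≈ 0#) ×
    (sumTo N (λ a → sumTo N (λ b → F a b n)) ≈ s n)

  HasSum2 : (ℕ → ℕ → PS2) → PS2 → Set ℓ
  HasSum2 F s = ∀ n m → Σ ℕ λ N →
    (∀ a b → (N ≤ a ⊎ N ≤ b) → F a b n m ≈ 0#) ×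
    (sumTo N (λ a → sumTo N (λ b → F a b n m)) ≈ s n m)

  IsDual : K → PS2 → (ℕ → ℕ → K) → Set ℓ
  IsDual q P T = HasSum2 (λ a b → scale2 (T a b) (predual q P a b)) tSer2

  Aop : K → PS → PS → PS
  Aop q P1 f = P1 ⊛ dil q f

module Submission where

-- Iterating A f(z) = P(z,1) f(qz) gives  A^b f = ∏_{j<b} P(q^j z,1) · f(q^b z),
-- which is statement (ii) once we know the defining family of T f is
-- summable.  If  e(qz) P(z,1) = P(z,x) e(z),  the same iteration gives
-- A^b e = ∏_{j<b} P(q^j z,x) · e,  so  T e = (Σ_ab T_ab ẽ_ab(z,x)) · e = x e  by
-- evaluating the duality  Σ_ab T_ab ẽ_ab(z,t) = t  at t = x; with x = q^k
-- this is statement (i).  Summability comes from triangularity of the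
-- predual basis: ẽ_(a,b) is divisible by z^a and ẽ_(a,b)(0,t) = t^b, so
-- comparing coefficients of z^n t^m in the duality shows, row by row, that
-- for a ≤ n only finitely many T_ab are nonzero.

open import Defs
open import Level using (Level)
open import Data.Nat as Nat using (ℕ; zero; suc; _∸_; _≤_; _<_; z≤n; s≤s; _≟_; _≤?_; _<?_)
import Data.Nat.Properties as ℕₚ
open import Data.Product using (Σ; _×_; _,_; proj₁; proj₂)
open import Data.Sum using (_⊎_; inj₁; inj₂)
open import Data.Empty using (⊥-elim)
open import Relation.Nullary using (yes; no)
open import Relation.Binary.PropositionalEquality as ≡ using (_≡_; _≢_)
open import Relation.Binary.Bundles using (Setoid)
open import Algebra.Bundles using (CommutativeRing)

module Proof {c ℓ : Level} (R : CommutativeRing c ℓ) where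
  open CommutativeRing R renaming (Carrier to K)
  open Series R
  open import Algebra.Properties.CommutativeSemigroup +-commutativeSemigroup
    using () renaming (interchange to +-interchange)
  open import Algebra.Properties.CommutativeSemigroup *-commutativeSemigroup
    using () renaming (interchange to *-interchange; x∙yz≈y∙xz to *-left-comm)
  open import Algebra.Properties.Ring ring using (-0#≈0#)

  module FiniteSums where
    open import Relation.Binary.Reasoning.Setoid setoid

    sum-cong< : ∀ n {f g : ℕ → K} → (∀ i → i < n → f i ≈ g i) → sumTo n f ≈ sumTo n g
    sum-cong< zero    h = refl
    sum-cong< (suc n) h = +-cong (sum-cong< n (λ i i<n → h i (ℕₚ.m<n⇒m<1+n i<n))) (h n ℕₚ.≤-refl)

    sum-cong : ∀ n {f g : ℕ → K} → (∀ i → f i ≈ g i) → sumTo n f ≈ sumTo n g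
    sum-cong n h = sum-cong< n (λ i _ → h i)

    sum-zero : ∀ n {f : ℕ → K} → (∀ i → i < n → f i ≈ 0#) → sumTo n f ≈ 0#
    sum-zero n h = trans (sum-cong< n h) (sum-of-zeros n)
      where
      sum-of-zeros : ∀ n → sumTo n (λ _ → 0#) ≈ 0#
      sum-of-zeros zero    = refl
      sum-of-zeros (suc n) = trans (+-identityʳ _) (sum-of-zeros n)

    sum-+ : ∀ n (f g : ℕ → K) → sumTo n (λ i → f i + g i) ≈ sumTo n f + sumTo n g
    sum-+ zero    f g = sym (+-identityˡ 0#)
    sum-+ (suc n) f g = trans (+-congʳ (sum-+ n f g)) (+-interchange _ _ _ _)

    sum-*ˡ : ∀ n x (f : ℕ → K) → x * sumTo n f ≈ sumTo n (λ i → x * f i)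
    sum-*ˡ zero    x f = zeroʳ x
    sum-*ˡ (suc n) x f = trans (distribˡ x _ _) (+-congʳ (sum-*ˡ n x f))

    sum-*ʳ : ∀ n x (f : ℕ → K) → sumTo n f * x ≈ sumTo n (λ i → f i * x)
    sum-*ʳ zero    x f = zeroˡ x
    sum-*ʳ (suc n) x f = trans (distribʳ x _ _) (+-congʳ (sum-*ʳ n x f))

    sum-swap : ∀ n m (f : ℕ → ℕ → K) →
      sumTo n (λ i → sumTo m (f i)) ≈ sumTo m (λ j → sumTo n (λ i → f i j))
    sum-swap zero    m f = sym (sum-zero m (λ _ _ → refl))
    sum-swap (suc n) m f = trans (+-congʳ (sum-swap n m f)) (sym (sum-+ m _ _))

    sum-first : ∀ n (f : ℕ → K) → sumTo (suc n) f ≈ f 0 + sumTo n (λ i → f (suc i))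
    sum-first zero    f = trans (+-identityˡ _) (sym (+-identityʳ _))
    sum-first (suc n) f = trans (+-congʳ (sum-first n f)) (+-assoc _ _ _)

    sum-pad : ∀ n k {f : ℕ → K} → (∀ i → n ≤ i → f i ≈ 0#) → sumTo (n Nat.+ k) f ≈ sumTo n f
    sum-pad n zero    {f} h rewrite ℕₚ.+-identityʳ n = refl
    sum-pad n (suc k) {f} h rewrite ℕₚ.+-suc n k =
      trans (+-cong (sum-pad n k h) (h (n Nat.+ k) (ℕₚ.m≤m+n n k))) (+-identityʳ _)

    sum-extend : ∀ {n m} {f : ℕ → K} → n ≤ m → (∀ i → n ≤ i → f i ≈ 0#) → sumTo m f ≈ sumTo n f
    sum-extend {n} {m} {f} n≤m h =
      ≡.subst (λ k → sumTo k f ≈ sumTo n f) (ℕₚ.m+[n∸m]≡n n≤m) (sum-pad n (m ∸ n) h)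

    sum-range-indep : ∀ n m {f : ℕ → K} →
      (∀ i → n ≤ i → f i ≈ 0#) → (∀ i → m ≤ i → f i ≈ 0#) → sumTo n f ≈ sumTo m f
    sum-range-indep n m hn hm with ℕₚ.≤-total n m
    ... | inj₁ n≤m = sym (sum-extend n≤m hn)
    ... | inj₂ m≤n = sum-extend m≤n hm

    sum-single : ∀ n k {f : ℕ → K} → k < n → (∀ i → i < n → i ≢ k → f i ≈ 0#) → sumTo n f ≈ f k
    sum-single (suc n) k k<1+n h with k ≟ n
    ... | yes ≡.refl =
      trans (+-congʳ (sum-zero n (λ i i<n → h i (ℕₚ.m<n⇒m<1+n i<n) (ℕₚ.<⇒≢ i<n))))
            (+-identityˡ _)
    ... | no k≢n =
      trans (+-cong (sum-single n k (ℕₚ.≤∧≢⇒< (ℕₚ.≤-pred k<1+n) k≢n)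
                                    (λ i i<n → h i (ℕₚ.m<n⇒m<1+n i<n)))
                    (h n ℕₚ.≤-refl (λ n≡k → k≢n (≡.sym n≡k))))
            (+-identityʳ _)

    δ : ℕ → ℕ → K
    δ i j with i ≟ j
    ... | yes _ = 1#
    ... | no  _ = 0#

    δ-≡ : ∀ {i j} → i ≡ j → δ i j ≈ 1#
    δ-≡ {i} {j} i≡j with i ≟ j
    ... | yes _   = refl
    ... | no  i≢j = ⊥-elim (i≢j i≡j)

    δ-≢ : ∀ {i j} → i ≢ j → δ i j ≈ 0#
    δ-≢ {i} {j} i≢j with i ≟ j
    ... | yes i≡j = ⊥-elim (i≢j i≡j)
    ... | no  _   = refl

    δ-≢-* : ∀ {i j} x → i ≢ j → δ i j * x ≈ 0#
    δ-≢-* x i≢j = trans (*-congʳ (δ-≢ i≢j)) (zeroˡ x)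

    sum-δ : ∀ N k (F : ℕ → K) → (N ≤ k → F k ≈ 0#) → sumTo N (λ a → δ k a * F a) ≈ F k
    sum-δ N k F h with k <? N
    ... | yes k<N =
      trans (sum-single N k k<N (λ a _ a≢k → δ-≢-* {k} {a} (F a) (λ k≡a → a≢k (≡.sym k≡a))))
            (trans (*-congʳ (δ-≡ {k} ≡.refl)) (*-identityˡ _))
    ... | no k≮N =
      trans (sum-zero N (λ a a<N → δ-≢-* {k} {a} (F a) (λ { ≡.refl → k≮N a<N })))
            (sym (h (ℕₚ.≮⇒≥ k≮N)))

    sum2 : ℕ → (ℕ → ℕ → K) → K
    sum2 N F = sumTo N (λ a → sumTo N (F a))

    sum2-cong : ∀ N {F G : ℕ → ℕ → K} → (∀ a b → F a b ≈ G a b) → sum2 N F ≈ sum2 N G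
    sum2-cong N h = sum-cong N (λ a → sum-cong N (h a))

    sum2-*ˡ : ∀ N x (F : ℕ → ℕ → K) → x * sum2 N F ≈ sum2 N (λ a b → x * F a b)
    sum2-*ˡ N x F = trans (sum-*ˡ N x _) (sum-cong N (λ a → sum-*ˡ N x (F a)))

    sum2-*ʳ : ∀ N x (F : ℕ → ℕ → K) → sum2 N F * x ≈ sum2 N (λ a b → F a b * x)
    sum2-*ʳ N x F = trans (sum-*ʳ N x _) (sum-cong N (λ a → sum-*ʳ N x (F a)))

    sum2-swap : ∀ N M (G : ℕ → ℕ → ℕ → K) →
      sum2 N (λ a b → sumTo M (G a b)) ≈ sumTo M (λ m → sum2 N (λ a b → G a b m))
    sum2-swap N M G = trans (sum-cong N (λ a → sum-swap N M (G a))) (sum-swap N M _)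

    sum3-rotate : ∀ N (G : ℕ → ℕ → ℕ → K) →
      sumTo N (λ a → sum2 N (G a)) ≈ sum2 N (λ j k → sumTo N (λ a → G a j k))
    sum3-rotate N G = trans (sum-swap N N _) (sum-cong N (λ j → sum-swap N N _))

    sum2-box-indep : ∀ N₁ N₂ (F : ℕ → ℕ → K) →
      (∀ a b → (N₁ ≤ a ⊎ N₁ ≤ b) → F a b ≈ 0#) →
      (∀ a b → (N₂ ≤ a ⊎ N₂ ≤ b) → F a b ≈ 0#) → sum2 N₁ F ≈ sum2 N₂ F
    sum2-box-indep N₁ N₂ F h₁ h₂ = trans
      (sum-cong N₁ (λ a → sum-range-indep N₁ N₂ (λ b p → h₁ a b (inj₂ p)) (λ b p → h₂ a b (inj₂ p))))
      (sum-range-indep N₁ N₂ (λ a p → sum-zero N₂ (λ b _ → h₁ a b (inj₁ p)))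
                             (λ a p → sum-zero N₂ (λ b _ → h₂ a b (inj₁ p))))

    sum2-isolated : ∀ N (F : ℕ → ℕ → K) i j →
      (∀ a b → (N ≤ a ⊎ N ≤ b) → F a b ≈ 0#) →
      (∀ a b → a ≢ i → F a b ≈ 0#) → (∀ b → b ≢ j → F i b ≈ 0#) → sum2 N F ≈ F i j
    sum2-isolated N F i j outside off-row off-col with i <? N | j <? N
    ... | yes i<N | yes j<N =
      trans (sum-single N i i<N (λ a _ a≢i → sum-zero N (λ b _ → off-row a b a≢i)))
            (sum-single N j j<N (λ b _ b≢j → off-col b b≢j))
    ... | no i≮N | _ =
      trans (sum-zero N (λ a a<N → sum-zero N (λ b _ → off-row a b (λ { ≡.refl → i≮N a<N }))))
            (sym (outside i j (inj₁ (ℕₚ.≮⇒≥ i≮N))))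
    ... | yes _ | no j≮N =
      trans (sum-cong N (λ a → sum-zero N (λ b b<N → col a b (λ { ≡.refl → j≮N b<N }))))
            (trans (sum-zero N (λ _ _ → refl)) (sym (outside i j (inj₂ (ℕₚ.≮⇒≥ j≮N)))))
      where
      col : ∀ a b → b ≢ j → F a b ≈ 0#
      col a b b≢j with a ≟ i
      ... | yes ≡.refl = off-col b b≢j
      ... | no a≢i    = off-row a b a≢i
  open FiniteSums

  module SeriesRing where
    open import Relation.Binary.Reasoning.Setoid setoid

    ≋-setoid : Setoid c ℓ
    ≋-setoid = record
      { Carrier       = PS
      ; _≈_           = _≋_
      ; isEquivalence = record
        { refl  = λ _ → refl
        ; sym   = λ f≋g n → sym (f≋g n)
        ; trans = λ f≋g g≋h n → trans (f≋g n) (g≋h n)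
        }
      }

    ≋-refl : ∀ {f} → f ≋ f
    ≋-refl = Setoid.refl ≋-setoid

    ⊛-cong : ∀ {f f′ g g′} → f ≋ f′ → g ≋ g′ → (f ⊛ g) ≋ (f′ ⊛ g′)
    ⊛-cong f≋f′ g≋g′ n = sum-cong (suc n) (λ a → *-cong (f≋f′ a) (g≋g′ (n ∸ a)))

    ⊛-congˡ : ∀ f {g g′} → g ≋ g′ → (f ⊛ g) ≋ (f ⊛ g′)
    ⊛-congˡ f = ⊛-cong {f} ≋-refl

    ⊛-congʳ : ∀ g {f f′} → f ≋ f′ → (f ⊛ g) ≋ (f′ ⊛ g)
    ⊛-congʳ g f≋f′ = ⊛-cong f≋f′ (≋-refl {g})

    δ-beyond : ∀ {m n} x → n < m → δ m n * x ≈ 0#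
    δ-beyond {m} {n} x n<m = δ-≢-* {m} {n} x (λ m≡n → ℕₚ.<⇒≢ n<m (≡.sym m≡n))

    ⊛-as-box-sum : ∀ N n f g → n < N →
      (f ⊛ g) n ≈ sum2 N (λ a b → δ (a Nat.+ b) n * (f a * g b))
    ⊛-as-box-sum N n f g n<N = sym (begin
      sum2 N (λ a b → δ (a Nat.+ b) n * (f a * g b))
        ≈⟨ sum-extend n<N (λ a n<a → sum-zero N (λ b _ →
             δ-beyond _ (ℕₚ.<-≤-trans n<a (ℕₚ.m≤m+n a b)))) ⟩
      sumTo (suc n) (λ a → sumTo N (λ b → δ (a Nat.+ b) n * (f a * g b)))
        ≈⟨ sum-cong< (suc n) (λ a a<1+n → column a (ℕₚ.≤-pred a<1+n)) ⟩
      (f ⊛ g) n ∎)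
      where
      -- for a ≤ n only b = n ∸ a contributes
      column : ∀ a → a ≤ n → sumTo N (λ b → δ (a Nat.+ b) n * (f a * g b)) ≈ f a * g (n ∸ a)
      column a a≤n = trans
        (sum-single N (n ∸ a) (ℕₚ.≤-<-trans (ℕₚ.m∸n≤m n a) n<N) (λ b _ b≢n∸a →
           δ-≢-* {a Nat.+ b} {n} _ (λ a+b≡n →
             b≢n∸a (≡.trans (≡.sym (ℕₚ.m+n∸m≡n a b)) (≡.cong (_∸ a) a+b≡n)))))
        (trans (*-congʳ (δ-≡ (ℕₚ.m+[n∸m]≡n a≤n))) (*-identityˡ _))

    ⊛-comm : ∀ f g → (f ⊛ g) ≋ (g ⊛ f)
    ⊛-comm f g n = begin
      (f ⊛ g) n
        ≈⟨ ⊛-as-box-sum N n f g ℕₚ.≤-refl ⟩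
      sum2 N (λ a b → δ (a Nat.+ b) n * (f a * g b))
        ≈⟨ sum-swap N N _ ⟩
      sum2 N (λ b a → δ (a Nat.+ b) n * (f a * g b))
        ≈⟨ sum2-cong N (λ b a → *-cong (reflexive (≡.cong (λ k → δ k n) (ℕₚ.+-comm a b)))
                                        (*-comm (f a) (g b))) ⟩
      sum2 N (λ b a → δ (b Nat.+ a) n * (g b * f a))
        ≈⟨ ⊛-as-box-sum N n g f ℕₚ.≤-refl ⟨
      (g ⊛ f) n ∎
      where N = suc n

    sum4-reorder : ∀ N (G : ℕ → ℕ → ℕ → ℕ → K) →
      sum2 N (λ a c → sum2 N (G a c)) ≈ sum2 N (λ i j → sum2 N (λ c a → G a c i j))
    sum4-reorder N G = trans (sum2-swap N N _)
      (sum-cong N (λ i → trans (sum2-swap N N _) (sum-cong N (λ j → sum-swap N N _))))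

    -- Both bracketings of f ⊛ g ⊛ h have n-th coefficient
    -- Σ_{i,j,c} [i+j+c = n] f_i g_j h_c.
    ⊛-assoc : ∀ f g h → ((f ⊛ g) ⊛ h) ≋ (f ⊛ (g ⊛ h))
    ⊛-assoc f g h n = trans left (sym right)
      where
      N = suc n
      W : ℕ → ℕ → ℕ → K
      W i j c = δ ((i Nat.+ j) Nat.+ c) n * ((f i * g j) * h c)

      left : ((f ⊛ g) ⊛ h) n ≈ sum2 N (λ i j → sumTo N (W i j))
      left = begin
        ((f ⊛ g) ⊛ h) n
          ≈⟨ ⊛-as-box-sum N n (f ⊛ g) h ℕₚ.≤-refl ⟩
        sum2 N (λ a c → δ (a Nat.+ c) n * ((f ⊛ g) a * h c))
          ≈⟨ sum-cong< N (λ a a<N → sum-cong N (λ c → expand a c a<N)) ⟩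
        sum2 N (λ a c → sum2 N (λ i j → δ (i Nat.+ j) a * (δ (a Nat.+ c) n * ((f i * g j) * h c))))
          ≈⟨ sum4-reorder N _ ⟩
        sum2 N (λ i j → sum2 N (λ c a → δ (i Nat.+ j) a * (δ (a Nat.+ c) n * ((f i * g j) * h c))))
          ≈⟨ sum2-cong N (λ i j → sum-cong N (λ c → sum-δ N (i Nat.+ j) _ (λ N≤i+j →
               δ-beyond _ (ℕₚ.<-≤-trans N≤i+j (ℕₚ.m≤m+n (i Nat.+ j) c))))) ⟩
        sum2 N (λ i j → sumTo N (W i j)) ∎
        where
        expand : ∀ a c → a < N → δ (a Nat.+ c) n * ((f ⊛ g) a * h c) ≈
          sum2 N (λ i j → δ (i Nat.+ j) a * (δ (a Nat.+ c) n * ((f i * g j) * h c)))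
        expand a c a<N = begin
          δ (a Nat.+ c) n * ((f ⊛ g) a * h c)
            ≈⟨ *-congˡ (*-congʳ (⊛-as-box-sum N a f g a<N)) ⟩
          δ (a Nat.+ c) n * (sum2 N (λ i j → δ (i Nat.+ j) a * (f i * g j)) * h c)
            ≈⟨ trans (*-congˡ (sum2-*ʳ N _ _)) (sum2-*ˡ N _ _) ⟩
          sum2 N (λ i j → δ (a Nat.+ c) n * ((δ (i Nat.+ j) a * (f i * g j)) * h c))
            ≈⟨ sum2-cong N (λ i j → trans (*-congˡ (*-assoc _ _ _)) (*-left-comm _ _ _)) ⟩
          sum2 N (λ i j → δ (i Nat.+ j) a * (δ (a Nat.+ c) n * ((f i * g j) * h c))) ∎

      right : (f ⊛ (g ⊛ h)) n ≈ sum2 N (λ i j → sumTo N (W i j))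
      right = begin
        (f ⊛ (g ⊛ h)) n
          ≈⟨ ⊛-as-box-sum N n f (g ⊛ h) ℕₚ.≤-refl ⟩
        sum2 N (λ i a → δ (i Nat.+ a) n * (f i * (g ⊛ h) a))
          ≈⟨ sum-cong N (λ i → sum-cong< N (λ a a<N → expand i a a<N)) ⟩
        sumTo N (λ i → sumTo N (λ a → sum2 N (λ j c → δ (j Nat.+ c) a * (δ (i Nat.+ a) n * (f i * (g j * h c))))))
          ≈⟨ sum-cong N (λ i → sum3-rotate N _) ⟩
        sum2 N (λ i j → sumTo N (λ c → sumTo N (λ a → δ (j Nat.+ c) a * (δ (i Nat.+ a) n * (f i * (g j * h c))))))
          ≈⟨ sum2-cong N (λ i j → sum-cong N (λ c → trans
               (sum-δ N (j Nat.+ c) _ (λ N≤j+c → δ-beyond _ (ℕₚ.<-≤-trans N≤j+c (ℕₚ.m≤n+m (j Nat.+ c) i))))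
               (*-cong (reflexive (≡.cong (λ k → δ k n) (≡.sym (ℕₚ.+-assoc i j c))))
                       (sym (*-assoc _ _ _))))) ⟩
        sum2 N (λ i j → sumTo N (W i j)) ∎
        where
        expand : ∀ i a → a < N → δ (i Nat.+ a) n * (f i * (g ⊛ h) a) ≈
          sum2 N (λ j c → δ (j Nat.+ c) a * (δ (i Nat.+ a) n * (f i * (g j * h c))))
        expand i a a<N = begin
          δ (i Nat.+ a) n * (f i * (g ⊛ h) a)
            ≈⟨ *-congˡ (*-congˡ (⊛-as-box-sum N a g h a<N)) ⟩
          δ (i Nat.+ a) n * (f i * sum2 N (λ j c → δ (j Nat.+ c) a * (g j * h c)))
            ≈⟨ trans (*-congˡ (sum2-*ˡ N _ _)) (sum2-*ˡ N _ _) ⟩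
          sum2 N (λ j c → δ (i Nat.+ a) n * (f i * (δ (j Nat.+ c) a * (g j * h c))))
            ≈⟨ sum2-cong N (λ j c → trans (*-congˡ (*-left-comm _ _ _)) (*-left-comm _ _ _)) ⟩
          sum2 N (λ j c → δ (j Nat.+ c) a * (δ (i Nat.+ a) n * (f i * (g j * h c)))) ∎

    oneS-⊛ : ∀ f → (oneS ⊛ f) ≋ f
    oneS-⊛ f n = trans (sum-first n _)
      (trans (+-cong (*-identityˡ _) (sum-zero n (λ i _ → zeroˡ _))) (+-identityʳ _))

    pow-+ : ∀ x a b → pow x (a Nat.+ b) ≈ pow x a * pow x b
    pow-+ x zero    b = sym (*-identityˡ _)
    pow-+ x (suc a) b = begin
      pow x (a Nat.+ b) * x     ≈⟨ *-congʳ (pow-+ x a b) ⟩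
      (pow x a * pow x b) * x   ≈⟨ *-assoc _ _ _ ⟩
      pow x a * (pow x b * x)   ≈⟨ *-congˡ (*-comm _ _) ⟩
      pow x a * (x * pow x b)   ≈⟨ *-assoc _ _ _ ⟨
      (pow x a * x) * pow x b   ∎

    pow-* : ∀ y x n → pow (y * x) n ≈ pow y n * pow x n
    pow-* y x zero    = sym (*-identityˡ _)
    pow-* y x (suc n) = trans (*-congʳ (pow-* y x n)) (*-interchange _ _ _ _)

    pow-1 : ∀ n → pow 1# n ≈ 1#
    pow-1 zero    = refl
    pow-1 (suc n) = trans (*-identityʳ _) (pow-1 n)

    dil-cong : ∀ x {f g} → f ≋ g → dil x f ≋ dil x g
    dil-cong x f≋g n = *-congˡ (f≋g n)

    dil-⊛ : ∀ x f g → dil x (f ⊛ g) ≋ (dil x f ⊛ dil x g)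
    dil-⊛ x f g n = trans (sum-*ˡ (suc n) _ _) (sum-cong< (suc n) (λ a a<1+n → begin
      pow x n * (f a * g (n ∸ a))
        ≈⟨ *-congʳ (trans (reflexive (≡.cong (pow x) (≡.sym (ℕₚ.m+[n∸m]≡n (ℕₚ.≤-pred a<1+n)))))
                          (pow-+ x a (n ∸ a))) ⟩
      (pow x a * pow x (n ∸ a)) * (f a * g (n ∸ a))
        ≈⟨ *-interchange _ _ _ _ ⟩
      (pow x a * f a) * (pow x (n ∸ a) * g (n ∸ a)) ∎))

    dil-dil : ∀ x y f → dil x (dil y f) ≋ dil (y * x) f
    dil-dil x y f n = trans (sym (*-assoc _ _ _)) (*-congʳ (trans (*-comm _ _) (sym (pow-* y x n))))

    dil-oneS : ∀ x → dil x oneS ≋ oneS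
    dil-oneS x zero    = *-identityˡ _
    dil-oneS x (suc n) = zeroʳ _

    dil-1 : ∀ f → dil 1# f ≋ f
    dil-1 f n = trans (*-congʳ (pow-1 n)) (*-identityˡ _)

    shiftZ-cong : ∀ a {f g} → f ≋ g → shiftZ a f ≋ shiftZ a g
    shiftZ-cong zero    f≋g n       = f≋g n
    shiftZ-cong (suc a) f≋g zero    = refl
    shiftZ-cong (suc a) f≋g (suc n) = shiftZ-cong a f≋g n

    shiftZ-below : ∀ a n (f : PS) → n < a → shiftZ a f n ≡ 0#
    shiftZ-below (suc a) zero    f _         = ≡.refl
    shiftZ-below (suc a) (suc n) f (s≤s n<a) = shiftZ-below a n f n<a

    shiftZ-above : ∀ a n (f : PS) → a ≤ n → shiftZ a f n ≡ f (n ∸ a)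
    shiftZ-above zero    n       f _         = ≡.refl
    shiftZ-above (suc a) (suc n) f (s≤s a≤n) = shiftZ-above a n f a≤n

    shiftZ2-below : ∀ a n m (F : PS2) → n < a → shiftZ2 a F n m ≡ 0#
    shiftZ2-below (suc a) zero    m F _         = ≡.refl
    shiftZ2-below (suc a) (suc n) m F (s≤s n<a) = shiftZ2-below a n m F n<a

    shiftZ2-above : ∀ a n m (F : PS2) → a ≤ n → shiftZ2 a F n m ≡ F (n ∸ a) m
    shiftZ2-above zero    n       m F _         = ≡.refl
    shiftZ2-above (suc a) (suc n) m F (s≤s a≤n) = shiftZ2-above a n m F a≤n

    shiftZ-⊛ : ∀ a f g → (shiftZ a f ⊛ g) ≋ shiftZ a (f ⊛ g)
    shiftZ-⊛ zero    f g n       = refl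
    shiftZ-⊛ (suc a) f g zero    = trans (+-identityˡ _) (zeroˡ _)
    shiftZ-⊛ (suc a) f g (suc n) =
      trans (sum-first (suc n) _) (trans (+-congʳ (zeroˡ _))
        (trans (+-identityˡ _) (shiftZ-⊛ a f g n)))

    HasSum-cong : ∀ {F G : ℕ → ℕ → PS} {s} → (∀ a b → F a b ≋ G a b) → HasSum F s → HasSum G s
    HasSum-cong F≋G summable n with summable n
    ... | N , outside , total =
      N , (λ a b out → trans (sym (F≋G a b n)) (outside a b out)) ,
      trans (sum2-cong N (λ a b → sym (F≋G a b n))) total
  open SeriesRing

  module Iterates (q : K) where
    open import Relation.Binary.Reasoning.Setoid ≋-setoid

    prodP1-suc : ∀ Y b → (dil q (prodP1 q Y b) ⊛ Y) ≋ prodP1 q Y (suc b)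
    prodP1-suc Y zero = begin
      dil q oneS ⊛ Y       ≈⟨ ⊛-congʳ Y (dil-oneS q) ⟩
      oneS ⊛ Y             ≈⟨ oneS-⊛ Y ⟩
      Y                    ≈⟨ dil-1 Y ⟨
      dil 1# Y             ≈⟨ oneS-⊛ (dil 1# Y) ⟨
      oneS ⊛ dil 1# Y      ∎
    prodP1-suc Y (suc b) = begin
      dil q (U ⊛ dil y Y) ⊛ Y              ≈⟨ ⊛-congʳ Y (dil-⊛ q U (dil y Y)) ⟩
      (dil q U ⊛ dil q (dil y Y)) ⊛ Y      ≈⟨ ⊛-congʳ Y (⊛-congˡ (dil q U) (dil-dil q y Y)) ⟩
      (dil q U ⊛ dil (y * q) Y) ⊛ Y        ≈⟨ ⊛-assoc (dil q U) (dil (y * q) Y) Y ⟩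
      dil q U ⊛ (dil (y * q) Y ⊛ Y)        ≈⟨ ⊛-congˡ (dil q U) (⊛-comm (dil (y * q) Y) Y) ⟩
      dil q U ⊛ (Y ⊛ dil (y * q) Y)        ≈⟨ ⊛-assoc (dil q U) Y (dil (y * q) Y) ⟨
      (dil q U ⊛ Y) ⊛ dil (y * q) Y        ≈⟨ ⊛-congʳ (dil (y * q) Y) (prodP1-suc Y b) ⟩
      prodP1 q Y (suc b) ⊛ dil (y * q) Y   ∎
      where
      U = prodP1 q Y b
      y = pow q b

    iterA-formula : ∀ P₁ f b → iter (Aop q P₁) b f ≋ (prodP1 q P₁ b ⊛ dil (pow q b) f)
    iterA-formula P₁ f zero = begin
      f                  ≈⟨ dil-1 f ⟨
      dil 1# f           ≈⟨ oneS-⊛ (dil 1# f) ⟨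
      oneS ⊛ dil 1# f    ∎
    iterA-formula P₁ f (suc b) = begin
      P₁ ⊛ dil q (iter (Aop q P₁) b f)     ≈⟨ ⊛-congˡ P₁ (dil-cong q (iterA-formula P₁ f b)) ⟩
      P₁ ⊛ dil q (U ⊛ dil y f)             ≈⟨ ⊛-congˡ P₁ (dil-⊛ q U (dil y f)) ⟩
      P₁ ⊛ (dil q U ⊛ dil q (dil y f))     ≈⟨ ⊛-congˡ P₁ (⊛-congˡ (dil q U) (dil-dil q y f)) ⟩
      P₁ ⊛ (dil q U ⊛ dil (y * q) f)       ≈⟨ ⊛-assoc P₁ (dil q U) (dil (y * q) f) ⟨
      (P₁ ⊛ dil q U) ⊛ dil (y * q) f       ≈⟨ ⊛-congʳ (dil (y * q) f) (⊛-comm P₁ (dil q U)) ⟩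
      (dil q U ⊛ P₁) ⊛ dil (y * q) f       ≈⟨ ⊛-congʳ (dil (y * q) f) (prodP1-suc P₁ b) ⟩
      prodP1 q P₁ (suc b) ⊛ dil (y * q) f  ∎
      where
      U = prodP1 q P₁ b
      y = pow q b

    iterA-eigen : ∀ P₁ Y e → (dil q e ⊛ P₁) ≋ (Y ⊛ e) →
      ∀ b → iter (Aop q P₁) b e ≋ (prodP1 q Y b ⊛ e)
    iterA-eigen P₁ Y e shift zero = Setoid.sym ≋-setoid (oneS-⊛ e)
    iterA-eigen P₁ Y e shift (suc b) = begin
      P₁ ⊛ dil q (iter (Aop q P₁) b e)   ≈⟨ ⊛-congˡ P₁ (dil-cong q (iterA-eigen P₁ Y e shift b)) ⟩
      P₁ ⊛ dil q (V ⊛ e)                 ≈⟨ ⊛-congˡ P₁ (dil-⊛ q V e) ⟩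
      P₁ ⊛ (dil q V ⊛ dil q e)           ≈⟨ ⊛-comm P₁ (dil q V ⊛ dil q e) ⟩
      (dil q V ⊛ dil q e) ⊛ P₁           ≈⟨ ⊛-assoc (dil q V) (dil q e) P₁ ⟩
      dil q V ⊛ (dil q e ⊛ P₁)           ≈⟨ ⊛-congˡ (dil q V) shift ⟩
      dil q V ⊛ (Y ⊛ e)                  ≈⟨ ⊛-assoc (dil q V) Y e ⟨
      (dil q V ⊛ Y) ⊛ e                  ≈⟨ ⊛-congʳ e (prodP1-suc Y b) ⟩
      prodP1 q Y (suc b) ⊛ e             ∎
      where
      V = prodP1 q Y b

  -- Evaluation t := x of bivariate series.  evalT D F x is the right value
  -- of F(z,x) when D bounds the t-degree of F; we use bounds valid uniformly
  -- in all z-degrees up to n:  F s m = 0  whenever  s ≤ n  and  D n ≤ m.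
  module Evaluation where
    open import Relation.Binary.Reasoning.Setoid setoid

    TDegreeBound : PS2 → (ℕ → ℕ) → Set ℓ
    TDegreeBound F D = ∀ n s m → s ≤ n → D n ≤ m → F s m ≈ 0#

    ⊛₂-bound : ∀ F G DF DG → TDegreeBound F DF → TDegreeBound G DG →
      TDegreeBound (F ⊛₂ G) (λ n → DF n Nat.+ DG n)
    ⊛₂-bound F G DF DG boundF boundG n s m s≤n DF+DG≤m =
      sum-zero (suc s) (λ a a<1+s → sum-zero (suc m) (λ b _ → term a b (ℕₚ.≤-pred a<1+s)))
      where
      term : ∀ a b → a ≤ s → F a b * G (s ∸ a) (m ∸ b) ≈ 0#
      term a b a≤s with DF n ≤? b
      ... | yes DF≤b = trans (*-congʳ (boundF n a b (ℕₚ.≤-trans a≤s s≤n) DF≤b)) (zeroˡ _)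
      ... | no  DF≰b = trans (*-congˡ (boundG n (s ∸ a) (m ∸ b) (ℕₚ.≤-trans (ℕₚ.m∸n≤m s a) s≤n) DG≤m∸b))
                             (zeroʳ _)
        where
        DG≤m∸b : DG n ≤ m ∸ b
        DG≤m∸b = ≡.subst (_≤ m ∸ b) (ℕₚ.m+n∸m≡n b (DG n))
          (ℕₚ.∸-monoˡ-≤ b (ℕₚ.≤-trans (ℕₚ.+-monoˡ-≤ (DG n) (ℕₚ.<⇒≤ (ℕₚ.≰⇒> DF≰b))) DF+DG≤m))

    eval-poly-⊛ : ∀ x M₁ M₂ (f g : PS) → (∀ i → M₁ ≤ i → f i ≈ 0#) → (∀ i → M₂ ≤ i → g i ≈ 0#) →
      sumTo M₁ (λ b → f b * pow x b) * sumTo M₂ (λ c → g c * pow x c) ≈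
      sumTo (M₁ Nat.+ M₂) (λ m → (f ⊛ g) m * pow x m)
    eval-poly-⊛ x M₁ M₂ f g f-deg g-deg = sym (begin
      sumTo M (λ m → (f ⊛ g) m * pow x m)
        ≈⟨ sum-cong< M (λ m m<M → trans (*-congʳ (⊛-as-box-sum M m f g m<M)) (sum2-*ʳ M _ _)) ⟩
      sumTo M (λ m → sum2 M (λ b c → (δ (b Nat.+ c) m * (f b * g c)) * pow x m))
        ≈⟨ sum3-rotate M _ ⟩
      sum2 M (λ b c → sumTo M (λ m → (δ (b Nat.+ c) m * (f b * g c)) * pow x m))
        ≈⟨ sum2-cong M (λ b c → trans (sum-cong M (λ m → *-assoc _ _ _))
             (sum-δ M (b Nat.+ c) (λ m → (f b * g c) * pow x m) (beyond b c))) ⟩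
      sum2 M (λ b c → (f b * g c) * pow x (b Nat.+ c))
        ≈⟨ sum2-cong M (λ b c → trans (*-congˡ (pow-+ x b c)) (*-interchange _ _ _ _)) ⟩
      sum2 M (λ b c → (f b * pow x b) * (g c * pow x c))
        ≈⟨ trans (sum-*ʳ M _ _) (sum-cong M (λ b → sum-*ˡ M _ _)) ⟨
      sumTo M (λ b → f b * pow x b) * sumTo M (λ c → g c * pow x c)
        ≈⟨ *-cong (sum-extend (ℕₚ.m≤m+n M₁ M₂) (λ i M₁≤i → trans (*-congʳ (f-deg i M₁≤i)) (zeroˡ _)))
                  (sum-extend (ℕₚ.m≤n+m M₂ M₁) (λ i M₂≤i → trans (*-congʳ (g-deg i M₂≤i)) (zeroˡ _))) ⟩
      sumTo M₁ (λ b → f b * pow x b) * sumTo M₂ (λ c → g c * pow x c) ∎)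
      where
      M = M₁ Nat.+ M₂
      beyond : ∀ b c → M ≤ b Nat.+ c → (f b * g c) * pow x (b Nat.+ c) ≈ 0#
      beyond b c M≤b+c with M₁ ≤? b | M₂ ≤? c
      ... | yes M₁≤b | _ = trans (*-congʳ (trans (*-congʳ (f-deg b M₁≤b)) (zeroˡ _))) (zeroˡ _)
      ... | no _ | yes M₂≤c = trans (*-congʳ (trans (*-congˡ (g-deg c M₂≤c)) (zeroʳ _))) (zeroˡ _)
      ... | no M₁≰b | no M₂≰c =
        ⊥-elim (ℕₚ.<⇒≱ (ℕₚ.+-mono-< (ℕₚ.≰⇒> M₁≰b) (ℕₚ.≰⇒> M₂≰c)) M≤b+c)

    evalT-widen : ∀ x F D → TDegreeBound F D → ∀ {n s} → s ≤ n →
      evalT D F x s ≈ sumTo (D n) (λ m → F s m * pow x m)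
    evalT-widen x F D bound {n} {s} s≤n = sum-range-indep (D s) (D n)
      (λ m Ds≤m → trans (*-congʳ (bound s s m ℕₚ.≤-refl Ds≤m)) (zeroˡ _))
      (λ m Dn≤m → trans (*-congʳ (bound n s m s≤n Dn≤m)) (zeroˡ _))

    evalT-⊛₂ : ∀ x F G DF DG → TDegreeBound F DF → TDegreeBound G DG →
      (evalT DF F x ⊛ evalT DG G x) ≋ evalT (λ n → DF n Nat.+ DG n) (F ⊛₂ G) x
    evalT-⊛₂ x F G DF DG boundF boundG n = begin
      sumTo (suc n) (λ a → evalT DF F x a * evalT DG G x (n ∸ a))
        ≈⟨ sum-cong< (suc n) (λ a a<1+n → trans
             (*-cong (evalT-widen x F DF boundF (ℕₚ.≤-pred a<1+n))
                     (evalT-widen x G DG boundG (ℕₚ.m∸n≤m n a)))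
             (eval-poly-⊛ x (DF n) (DG n) (F a) (G (n ∸ a))
                (λ i → boundF n a i (ℕₚ.≤-pred a<1+n)) (λ i → boundG n (n ∸ a) i (ℕₚ.m∸n≤m n a)))) ⟩
      sumTo (suc n) (λ a → sumTo D (λ m → (F a ⊛ G (n ∸ a)) m * pow x m))
        ≈⟨ sum-swap (suc n) D _ ⟩
      sumTo D (λ m → sumTo (suc n) (λ a → (F a ⊛ G (n ∸ a)) m * pow x m))
        ≈⟨ sum-cong D (λ m → sum-*ʳ (suc n) _ _) ⟨
      evalT (λ n → DF n Nat.+ DG n) (F ⊛₂ G) x n ∎
      where D = DF n Nat.+ DG n

    evalT-dil2 : ∀ x y D F → dil y (evalT D F x) ≋ evalT D (dil2 y F) x
    evalT-dil2 x y D F n = trans (sum-*ˡ (D n) _ _) (sum-cong (D n) (λ m → sym (*-assoc _ _ _)))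

    evalT-oneS2 : ∀ x → evalT (λ _ → 1) oneS2 x ≋ oneS
    evalT-oneS2 x zero    = trans (+-identityˡ _) (*-identityˡ _)
    evalT-oneS2 x (suc n) = trans (+-identityˡ _) (zeroˡ _)

    oneS2-bound : TDegreeBound oneS2 (λ _ → 1)
    oneS2-bound n zero    (suc m) _ _ = refl
    oneS2-bound n (suc s) m       _ _ = refl

    dil2-bound : ∀ y F D → TDegreeBound F D → TDegreeBound (dil2 y F) D
    dil2-bound y F D bound n s m s≤n D≤m = trans (*-congˡ (bound n s m s≤n D≤m)) (zeroʳ _)

    shiftZ-evalT : ∀ x F D → TDegreeBound F D → ∀ a c M → D c ≤ M →
      shiftZ a (evalT D F x) c ≈ sumTo M (λ m → shiftZ2 a F c m * pow x m)
    shiftZ-evalT x F D bound a c M Dc≤M with a ≤? c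
    ... | no a≰c = trans (reflexive (shiftZ-below a c _ c<a))
        (sym (sum-zero M (λ m _ → trans (*-congʳ (reflexive (shiftZ2-below a c m F c<a))) (zeroˡ _))))
      where c<a = ℕₚ.≰⇒> a≰c
    ... | yes a≤c = begin
      shiftZ a (evalT D F x) c
        ≡⟨ shiftZ-above a c _ a≤c ⟩
      evalT D F x (c ∸ a)
        ≈⟨ evalT-widen x F D bound (ℕₚ.m∸n≤m c a) ⟩
      sumTo (D c) (λ m → F (c ∸ a) m * pow x m)
        ≈⟨ sum-extend Dc≤M (λ m Dc≤m → trans (*-congʳ (bound c (c ∸ a) m (ℕₚ.m∸n≤m c a) Dc≤m)) (zeroˡ _)) ⟨
      sumTo M (λ m → F (c ∸ a) m * pow x m)
        ≈⟨ sum-cong M (λ m → *-congʳ (reflexive (≡.sym (shiftZ2-above a c m F a≤c)))) ⟩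
      sumTo M (λ m → shiftZ2 a F c m * pow x m) ∎
  open Evaluation

  module SeriesT where
    tSer2-high : ∀ n m → 2 ≤ m → tSer2 n m ≈ 0#
    tSer2-high zero    (suc (suc m)) _         = refl
    tSer2-high zero    (suc zero)    (s≤s ())
    tSer2-high (suc n) m             _         = refl

    tSer2-z⁰ : ∀ k → k ≢ 1 → tSer2 0 k ≈ 0#
    tSer2-z⁰ zero          _   = refl
    tSer2-z⁰ (suc zero)    k≢1 = ⊥-elim (k≢1 ≡.refl)
    tSer2-z⁰ (suc (suc k)) _   = refl

    evalT-tSer2 : ∀ x M c → 2 ≤ M → sumTo M (λ m → tSer2 c m * pow x m) ≈ x * oneS c
    evalT-tSer2 x M zero 2≤M =
      trans (sum-single M 1 2≤M (λ m _ m≢1 → trans (*-congʳ (tSer2-z⁰ m m≢1)) (zeroˡ _)))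
            (trans (*-identityˡ _) (trans (*-identityˡ x) (sym (*-identityʳ x))))
    evalT-tSer2 x M (suc c) _ = trans (sum-zero M (λ m _ → zeroˡ _)) (sym (zeroʳ x))
  open SeriesT

  module PredualBasis (q : K) (P : PS2) (catalan : IsCatalan P)
                      (B : ℕ → ℕ) (P-deg : ∀ n m → B n ≤ m → P n m ≈ 0#) where

    -- B 0 + ... + B n bounds the t-degree of P uniformly in z-degree ≤ n.
    Bcum : ℕ → ℕ
    Bcum zero    = B 0
    Bcum (suc n) = Bcum n Nat.+ B (suc n)

    B≤Bcum : ∀ {s n} → s ≤ n → B s ≤ Bcum n
    B≤Bcum {n = zero}  z≤n    = ℕₚ.≤-refl
    B≤Bcum {s} {suc n} s≤1+n with ℕₚ.m≤n⇒m<n∨m≡n s≤1+n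
    ... | inj₁ s<1+n  = ℕₚ.≤-trans (B≤Bcum (ℕₚ.≤-pred s<1+n)) (ℕₚ.m≤m+n _ _)
    ... | inj₂ ≡.refl = ℕₚ.m≤n+m _ _

    P-bound : TDegreeBound P Bcum
    P-bound n s m s≤n Bcum≤m = P-deg s m (ℕₚ.≤-trans (B≤Bcum s≤n) Bcum≤m)

    evalT-Bcum : ∀ x → evalT B P x ≋ evalT Bcum P x
    evalT-Bcum x n = sum-range-indep (B n) (Bcum n)
      (λ m B≤m → trans (*-congʳ (P-deg n m B≤m)) (zeroˡ _))
      (λ m Bcum≤m → trans (*-congʳ (P-bound n n m ℕₚ.≤-refl Bcum≤m)) (zeroˡ _))

    Π₂ : ℕ → PS2
    Π₂ = prodP2 q P

    -- 1 + b · Bcum n  bounds the t-degree of Π₂_b in z-degree ≤ n.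
    prodBound : ℕ → ℕ → ℕ
    prodBound zero    n = 1
    prodBound (suc b) n = prodBound b n Nat.+ Bcum n

    prodBound-mono : ∀ n {b b′} → b ≤ b′ → prodBound b n ≤ prodBound b′ n
    prodBound-mono n {b′ = zero}  z≤n     = ℕₚ.≤-refl
    prodBound-mono n {b} {suc b′} b≤1+b′ with ℕₚ.m≤n⇒m<n∨m≡n b≤1+b′
    ... | inj₁ b<1+b′ = ℕₚ.≤-trans (prodBound-mono n (ℕₚ.≤-pred b<1+b′)) (ℕₚ.m≤m+n _ _)
    ... | inj₂ ≡.refl = ℕₚ.≤-refl

    Π₂-bound : ∀ b → TDegreeBound (Π₂ b) (prodBound b)
    Π₂-bound zero    = oneS2-bound
    Π₂-bound (suc b) = ⊛₂-bound (Π₂ b) (dil2 (pow q b) P) (prodBound b) Bcum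
                                (Π₂-bound b) (dil2-bound (pow q b) P Bcum P-bound)

    prodP1-evalT : ∀ x b → prodP1 q (evalT B P x) b ≋ evalT (prodBound b) (Π₂ b) x
    prodP1-evalT x zero    n = sym (evalT-oneS2 x n)
    prodP1-evalT x (suc b) = Setoid.trans ≋-setoid
      (⊛-cong (prodP1-evalT x b)
              (Setoid.trans ≋-setoid (dil-cong (pow q b) (evalT-Bcum x)) (evalT-dil2 x (pow q b) Bcum P)))
      (evalT-⊛₂ x (Π₂ b) (dil2 (pow q b) P) (prodBound b) Bcum
                (Π₂-bound b) (dil2-bound (pow q b) P Bcum P-bound))

    P-z⁰ : ∀ k → P 0 k ≈ tSer2 0 k
    P-z⁰ k = trans (proj₂ catalan 0 k) (trans (+-congˡ -0#≈0#) (+-identityʳ _))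

    Π₂-z⁰-diag : ∀ b → Π₂ b 0 b ≈ 1#
    Π₂-z⁰-off  : ∀ b m → m ≢ b → Π₂ b 0 m ≈ 0#

    Π₂-z⁰-diag zero    = refl
    Π₂-z⁰-diag (suc b) = trans (+-identityˡ _)
      (trans (sum-single (suc (suc b)) b (ℕₚ.m<n⇒m<1+n ℕₚ.≤-refl)
                (λ c _ c≢b → trans (*-congʳ (Π₂-z⁰-off b c c≢b)) (zeroˡ _)))
      (trans (*-cong (Π₂-z⁰-diag b) (*-identityˡ _))
      (trans (*-identityˡ _)
      (trans (P-z⁰ (suc b ∸ b)) (reflexive (≡.cong (tSer2 0) (ℕₚ.m+n∸n≡m 1 b)))))))

    Π₂-z⁰-off zero    zero    0≢0 = ⊥-elim (0≢0 ≡.refl)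
    Π₂-z⁰-off zero    (suc m) _   = refl
    Π₂-z⁰-off (suc b) m m≢1+b = trans (+-identityˡ _) (sum-zero (suc m) term)
      where
      term : ∀ c → c < suc m → Π₂ b 0 c * (1# * P 0 (m ∸ c)) ≈ 0#
      term c c<1+m with c ≟ b
      ... | no  c≢b    = trans (*-congʳ (Π₂-z⁰-off b c c≢b)) (zeroˡ _)
      ... | yes ≡.refl = trans (*-congˡ (trans (*-identityˡ _) (trans (P-z⁰ (m ∸ c)) (tSer2-z⁰ (m ∸ c) m∸c≢1))))
                               (zeroʳ _)
        where
        m∸c≢1 : m ∸ c ≢ 1
        m∸c≢1 m∸c≡1 = m≢1+b (≡.trans (≡.sym (ℕₚ.m+[n∸m]≡n (ℕₚ.≤-pred c<1+m)))
                                     (≡.trans (≡.cong (c Nat.+_) m∸c≡1) (ℕₚ.+-comm c 1)))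

  module DualCoefficients (q : K) (P : PS2) (catalan : IsCatalan P)
                          (B : ℕ → ℕ) (P-deg : ∀ n m → B n ≤ m → P n m ≈ 0#)
                          (T : ℕ → ℕ → K) (dual : IsDual q P T) where
    open PredualBasis q P catalan B P-deg
    open Iterates q
    open import Relation.Binary.Reasoning.Setoid setoid

    predual-diagonal : ∀ n b m → shiftZ2 n (Π₂ b) n m ≈ Π₂ b 0 m
    predual-diagonal n b m = reflexive
      (≡.trans (shiftZ2-above n n m (Π₂ b) ℕₚ.≤-refl) (≡.cong (λ s → Π₂ b s m) (ℕₚ.n∸n≡0 n)))

    -- If the rows a < n of T vanish from column R₀ on, then row n vanishes
    -- from column 2 + prodBound R₀ n on: in the [z^n t^m] coefficient of
    -- Σ T_ab ẽ_ab = t only the term T_nm survives, and t has no t^m.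
    dual-next-row : ∀ n R₀ → (∀ a b → a < n → R₀ ≤ b → T a b ≈ 0#) →
      ∀ m → 2 Nat.+ prodBound R₀ n ≤ m → T n m ≈ 0#
    dual-next-row n R₀ earlier m m-big with dual n m
    ... | N , outside , total = begin
      T n m                      ≈⟨ trans (*-congˡ (trans (predual-diagonal n m m) (Π₂-z⁰-diag m))) (*-identityʳ _) ⟨
      F n m                      ≈⟨ sum2-isolated N F n m outside off-row off-column ⟨
      sum2 N F                   ≈⟨ total ⟩
      tSer2 n m                  ≈⟨ tSer2-high n m (ℕₚ.≤-trans (ℕₚ.m≤m+n 2 _) m-big) ⟩
      0#                         ∎
      where
      F : ℕ → ℕ → K
      F a b = T a b * shiftZ2 a (Π₂ b) n m

      off-row : ∀ a b → a ≢ n → F a b ≈ 0#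
      off-row a b a≢n with a <? n
      ... | no a≮n = trans (*-congˡ (reflexive (shiftZ2-below a n m (Π₂ b)
                       (ℕₚ.≤∧≢⇒< (ℕₚ.≮⇒≥ a≮n) (λ n≡a → a≢n (≡.sym n≡a)))))) (zeroʳ _)
      ... | yes a<n with R₀ ≤? b
      ...   | yes R₀≤b = trans (*-congʳ (earlier a b a<n R₀≤b)) (zeroˡ _)
      ...   | no  R₀≰b = trans (*-congˡ (trans (reflexive (shiftZ2-above a n m (Π₂ b) (ℕₚ.<⇒≤ a<n)))
                           (Π₂-bound b n (n ∸ a) m (ℕₚ.m∸n≤m n a) prodBound≤m))) (zeroʳ _)
        where
        prodBound≤m : prodBound b n ≤ m
        prodBound≤m = ℕₚ.≤-trans (prodBound-mono n (ℕₚ.<⇒≤ (ℕₚ.≰⇒> R₀≰b)))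
                                 (ℕₚ.≤-trans (ℕₚ.m≤n+m _ 2) m-big)

      off-column : ∀ b → b ≢ m → F n b ≈ 0#
      off-column b b≢m = trans (*-congˡ (trans (predual-diagonal n b m)
                           (Π₂-z⁰-off b m (λ m≡b → b≢m (≡.sym m≡b))))) (zeroʳ _)

    rows-support : ∀ n → Σ ℕ λ R → ∀ a b → a < n → R ≤ b → T a b ≈ 0#
    rows-support zero    = 0 , λ a b ()
    rows-support (suc n) with rows-support n
    ... | R₀ , earlier = R₀ Nat.+ (2 Nat.+ prodBound R₀ n) , rows
      where
      rows : ∀ a b → a < suc n → R₀ Nat.+ (2 Nat.+ prodBound R₀ n) ≤ b → T a b ≈ 0#
      rows a b a<1+n big with ℕₚ.m≤n⇒m<n∨m≡n (ℕₚ.≤-pred a<1+n)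
      ... | inj₁ a<n    = earlier a b a<n (ℕₚ.≤-trans (ℕₚ.m≤m+n _ _) big)
      ... | inj₂ ≡.refl = dual-next-row a R₀ earlier b (ℕₚ.≤-trans (ℕₚ.m≤n+m _ R₀) big)

    support : ℕ → ℕ
    support n = proj₁ (rows-support (suc n))

    T-vanishes : ∀ n a b → a ≤ n → support n ≤ b → T a b ≈ 0#
    T-vanishes n a b a≤n = proj₂ (rows-support (suc n)) a b (s≤s a≤n)

    -- A term  T_ab y  vanishes past the support if y, like a coefficient of
    -- z^a X at z^c, vanishes for c < a.
    T-shifted-vanishes : ∀ n c → c ≤ n → ∀ a b (y : K) → (c < a → y ≈ 0#) →
      support n ≤ b → T a b * y ≈ 0#
    T-shifted-vanishes n c c≤n a b y shifted-out support≤b with a ≤? c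
    ... | yes a≤c = trans (*-congʳ (T-vanishes n a b (ℕₚ.≤-trans a≤c c≤n) support≤b)) (zeroˡ _)
    ... | no  a≰c = trans (*-congˡ (shifted-out (ℕₚ.≰⇒> a≰c))) (zeroʳ _)

    box : ℕ → ℕ
    box n = suc n Nat.+ support n

    T-outside-box : ∀ n c → c ≤ n → ∀ a b (y : K) → (c < a → y ≈ 0#) →
      (box n ≤ a ⊎ box n ≤ b) → T a b * y ≈ 0#
    T-outside-box n c c≤n a b y shifted-out (inj₁ box≤a) =
      trans (*-congˡ (shifted-out (ℕₚ.≤-<-trans c≤n (ℕₚ.≤-trans (ℕₚ.m≤m+n (suc n) _) box≤a)))) (zeroʳ _)
    T-outside-box n c c≤n a b y shifted-out (inj₂ box≤b) =
      T-shifted-vanishes n c c≤n a b y shifted-out (ℕₚ.≤-trans (ℕₚ.m≤n+m _ (suc n)) box≤b)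

    ΣX : (ℕ → ℕ → PS) → PS
    ΣX X n = sum2 (box n) (λ a b → T a b * shiftZ a (X a b) n)

    T-summable : ∀ X → HasSum (λ a b → scale (T a b) (shiftZ a (X a b))) (ΣX X)
    T-summable X n = box n , (λ a b → T-outside-box n n ℕₚ.≤-refl a b _
                                        (λ n<a → reflexive (shiftZ-below a n (X a b) n<a))) , refl

    dual-in-box : ∀ n c m → c ≤ n → sum2 (box n) (λ a b → T a b * shiftZ2 a (Π₂ b) c m) ≈ tSer2 c m
    dual-in-box n c m c≤n with dual c m
    ... | N , outside , total = trans
      (sum2-box-indep (box n) N _ (λ a b → T-outside-box n c c≤n a b _
                                     (λ c<a → reflexive (shiftZ2-below a c m (Π₂ b) c<a))) outside)
      total

    dual-at : ∀ x n c → c ≤ n →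
      sum2 (box n) (λ a b → T a b * shiftZ a (prodP1 q (evalT B P x) b) c) ≈ x * oneS c
    dual-at x n c c≤n = begin
      sum2 N (λ a b → T a b * shiftZ a (prodP1 q (evalT B P x) b) c)
        ≈⟨ sum2-cong N term ⟩
      sum2 N (λ a b → sumTo M (λ m → (T a b * shiftZ2 a (Π₂ b) c m) * pow x m))
        ≈⟨ sum2-swap N M _ ⟩
      sumTo M (λ m → sum2 N (λ a b → (T a b * shiftZ2 a (Π₂ b) c m) * pow x m))
        ≈⟨ sum-cong M (λ m → sum2-*ʳ N (pow x m) _) ⟨
      sumTo M (λ m → sum2 N (λ a b → T a b * shiftZ2 a (Π₂ b) c m) * pow x m)
        ≈⟨ sum-cong M (λ m → *-congʳ (dual-in-box n c m c≤n)) ⟩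
      sumTo M (λ m → tSer2 c m * pow x m)
        ≈⟨ evalT-tSer2 x M c (ℕₚ.m≤m+n 2 _) ⟩
      x * oneS c ∎
      where
      N = box n
      M = 2 Nat.+ prodBound (support n) c

      term : ∀ a b → T a b * shiftZ a (prodP1 q (evalT B P x) b) c ≈
                     sumTo M (λ m → (T a b * shiftZ2 a (Π₂ b) c m) * pow x m)
      term a b with support n ≤? b
      ... | yes support≤b =
        trans (T-shifted-vanishes n c c≤n a b _ (λ c<a → reflexive (shiftZ-below a c _ c<a)) support≤b)
              (sym (sum-zero M (λ m _ → trans (*-congʳ (T-shifted-vanishes n c c≤n a b _
                     (λ c<a → reflexive (shiftZ2-below a c m (Π₂ b) c<a)) support≤b)) (zeroˡ _))))
      ... | no support≰b = begin
        T a b * shiftZ a (prodP1 q (evalT B P x) b) c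
          ≈⟨ *-congˡ (shiftZ-cong a (prodP1-evalT x b) c) ⟩
        T a b * shiftZ a (evalT (prodBound b) (Π₂ b) x) c
          ≈⟨ *-congˡ (shiftZ-evalT x (Π₂ b) (prodBound b) (Π₂-bound b) a c M
               (ℕₚ.≤-trans (prodBound-mono c (ℕₚ.<⇒≤ (ℕₚ.≰⇒> support≰b))) (ℕₚ.m≤n+m _ 2))) ⟩
        T a b * sumTo M (λ m → shiftZ2 a (Π₂ b) c m * pow x m)
          ≈⟨ trans (sum-*ˡ M _ _) (sum-cong M (λ m → sym (*-assoc _ _ _))) ⟩
        sumTo M (λ m → (T a b * shiftZ2 a (Π₂ b) c m) * pow x m) ∎

    P₁ : PS
    P₁ = evalT B P 1#

    A : PS → PS
    A = Aop q P₁

    T-eigen : ∀ x e → (dil q e ⊛ P₁) ≋ (evalT B P x ⊛ e) →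
      HasSum (λ a b → scale (T a b) (shiftZ a (iter A b e))) (scale x e)
    T-eigen x e shift n with T-summable (λ _ b → iter A b e) n
    ... | N , outside , total = N , outside , trans total value
      where
      U : ℕ → PS
      U = prodP1 q (evalT B P x)

      value : ΣX (λ _ b → iter A b e) n ≈ x * e n
      value = begin
        sum2 (box n) (λ a b → T a b * shiftZ a (iter A b e) n)
          ≈⟨ sum2-cong (box n) (λ a b → *-congˡ (trans (shiftZ-cong a (iterA-eigen P₁ _ e shift b) n)
                                                       (sym (shiftZ-⊛ a (U b) e n)))) ⟩
        sum2 (box n) (λ a b → T a b * (shiftZ a (U b) ⊛ e) n)
          ≈⟨ sum2-cong (box n) (λ a b → trans (sum-*ˡ (suc n) _ _)
                                              (sum-cong (suc n) (λ c → sym (*-assoc _ _ _)))) ⟩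
        sum2 (box n) (λ a b → sumTo (suc n) (λ c → (T a b * shiftZ a (U b) c) * e (n ∸ c)))
          ≈⟨ sum2-swap (box n) (suc n) _ ⟩
        sumTo (suc n) (λ c → sum2 (box n) (λ a b → (T a b * shiftZ a (U b) c) * e (n ∸ c)))
          ≈⟨ sum-cong< (suc n) (λ c c<1+n → trans (sym (sum2-*ʳ (box n) _ _))
                                                  (*-congʳ (dual-at x n c (ℕₚ.≤-pred c<1+n)))) ⟩
        sumTo (suc n) (λ c → (x * oneS c) * e (n ∸ c))
          ≈⟨ sum-first n _ ⟩
        (x * 1#) * e n + sumTo n (λ c → (x * 0#) * e (n ∸ suc c))
          ≈⟨ +-cong (*-congʳ (*-identityʳ x)) (sum-zero n (λ c _ → trans (*-congʳ (zeroʳ x)) (zeroˡ _))) ⟩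
        x * e n + 0#
          ≈⟨ +-identityʳ _ ⟩
        x * e n ∎

    T-formula : ∀ f → Σ PS λ g →
      HasSum (λ a b → scale (T a b) (shiftZ a (iter A b f))) g
      × HasSum (λ a b → scale (T a b) (predualAt1 q P₁ a b ⊛ dil (pow q b) f)) g
    T-formula f = ΣX (λ _ b → iter A b f) , summable ,
      HasSum-cong (λ a b n → *-congˡ (trans (shiftZ-cong a (iterA-formula P₁ f b) n)
                                            (sym (shiftZ-⊛ a (prodP1 q P₁ b) (dil (pow q b) f) n))))
                  summable
      where summable = T-summable (λ _ b → iter A b f)

theorem4p9p1 : ∀ {c ℓ : Level} (R : CommutativeRing c ℓ) →
    let open CommutativeRing R renaming (Carrier to K) in
    let open Series R in
    (q : K) (P : PS2) → IsCatalan P →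
    (B : ℕ → ℕ) → (∀ n m → B n ≤ m → P n m ≈ 0#) →
    (e : ℕ → PS) →
    (∀ k → (dil q (e k) ⊛ evalT B P 1#) ≋ (evalT B P (pow q k) ⊛ e k)) →
    (T : ℕ → ℕ → K) → IsDual q P T →
    (∀ k → HasSum (λ a b → scale (T a b) (shiftZ a (iter (Aop q (evalT B P 1#)) b (e k))))
                  (scale (pow q k) (e k)))
    ×
    (∀ (f : PS) → Σ PS λ g →
      HasSum (λ a b → scale (T a b) (shiftZ a (iter (Aop q (evalT B P 1#)) b f))) g
      × HasSum (λ a b → scale (T a b) (predualAt1 q (evalT B P 1#) a b ⊛ dil (pow q b) f)) g)
theorem4p9p1 R q P catalan B P-deg e e-shift T dual =
  (λ k → T-eigen (pow q k) (e k) (e-shift k)) , T-formula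
  where
  open Series R using (pow)
  open Proof.DualCoefficients R q P catalan B P-deg T dual
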